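{- Let $m,n>0$ and let $(\mathfrak{q}_{1},\mathfrak{q}_{2},\ldots,\mathfrak{q}_{m})$ be an increasing $m$-fan of Dyck paths of length $2n$, where $\mathfrak q_j$ has height sequence $(h_{1}^{(j)},h_{2}^{(j)},\ldots,h_{n}^{(j)})$ for $j\in\{1,\ldots,m\}$. Then $(\mathfrak{q}_{1},\ldots,\mathfrak{q}_{m})=\delta(\mathfrak p)$ for some $m$-Dyck path $\mathfrak{p}\in D_{n}^{(m)}$ if and only if $h_{i}^{(k)}\leq h_{i+1}^{(j)}$ for all $i\in\{1,2,\ldots,n-2\}$ and all $j,k\in\{1,\dots,m\}$ with $k>j$.
   Context: $D_n^{(m)}$ is the set of lattice paths from $(0,0)$ to $(mn,n)$ with north- and east-steps staying weakly above the line $x=my$; $D_n=D_n^{(1)}$ is the set of Dyck paths of length $2n$. The height sequence of $\mathfrak p\in D_n^{(m)}$ is $(h_1,\dots,h_{mn})$, where $h_k$ is the height of the path at $x$-coordinate $k-\tfrac12$; height sequences are exactly the sequences with $h_1\le\cdots\le h_{mn}\le n$ and $h_k\ge\lceil k/m\rceil$, and they determine the path. The strip decomposition $\delta(\mathfrak p)=(\mathfrak q_1,\dots,\mathfrak q_m)\in (D_n)^m$ is defined by letting $\mathfrak q_i$ be the Dyck path with height sequence $(h_i,h_{i+m},h_{i+2m},\dots,h_{i+(n-1)m})$. For Dyck paths $\mathfrak q,\mathfrak q'\in D_n$ with height sequences $(h_i)$, $(h'_i)$, write $\mathfrak q\le_{\mathrm{dom}}\mathfrak q'$ if $h_i\le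 h'_i$ for all $i$. An $m$-tuple $(\mathfrak q_1,\dots,\mathfrak q_m)$ of Dyck paths in $D_n$ is an increasing $m$-fan if $\mathfrak q_1\le_{\mathrm{dom}}\mathfrak q_2\le_{\mathrm{dom}}\cdots\le_{\mathrm{dom}}\mathfrak q_m$. -}

module Defs where

open import Data.Nat using (ℕ; zero; suc; _+_; _*_; _∸_; _≤_; _<_)
open import Data.List using (List; []; _∷_; _++_; replicate; take; map; upTo)
open import Data.Fin using (Fin; toℕ)
open import Data.Product using (_×_)
open import Relation.Binary.PropositionalEquality using (_≡_)

data Step : Set where
  N E : Step

Path : Set
Path = List Step

countN : Path → ℕ
countN []       = 0
countN (N ∷ p) = suc (countN p)
countN (E ∷ p) = countN p

countE : Path → ℕ
countE []       = 0
countE (N ∷ p) = countE p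
countE (E ∷ p) = suc (countE p)

-- p ∈ D_n^(m): lattice path from (0,0) to (mn,n) with N/E steps, every
-- lattice point (x,y) visited satisfies x ≤ m*y (weakly above x = m y).
IsMDyck : ℕ → ℕ → Path → Set
IsMDyck m n p =
  countN p ≡ n × countE p ≡ m * n ×
  (∀ k → countE (take k p) ≤ m * countN (take k p))

IsDyck : ℕ → Path → Set
IsDyck n p = IsMDyck 1 n p

-- hgt p k = number of north steps before the (k+1)-th east step.
hgt : Path → ℕ → ℕ
hgt []       k       = 0
hgt (N ∷ p) k       = suc (hgt p k)
hgt (E ∷ p) zero    = 0
hgt (E ∷ p) (suc k) = hgt p k

-- 1-based height sequence: height p k = h_k = height at x = k - 1/2 (k ≥ 1).
height : Path → ℕ → ℕ
height p zero    = 0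
height p (suc k) = hgt p k

fromHeightsFrom : ℕ → ℕ → List ℕ → Path
fromHeightsFrom n cur []       = replicate (n ∸ cur) N
fromHeightsFrom n cur (h ∷ hs) = replicate (h ∸ cur) N ++ (E ∷ fromHeightsFrom n h hs)

fromHeights : ℕ → List ℕ → Path
fromHeights n hs = fromHeightsFrom n 0 hs

-- Strip decomposition δ(p) = (q_1,…,q_m); component j : Fin m is q_{toℕ j + 1},
-- the Dyck path with height sequence (h_i, h_{i+m}, …, h_{i+(n-1)m}), i = toℕ j + 1.
δ : (m n : ℕ) → Path → Fin m → Path
δ m n p j = fromHeights n (map (λ l → height p (suc (toℕ j) + l * m)) (upTo n))

_≤dom[_]_ : Path → ℕ → Path → Set
q ≤dom[ n ] q' = ∀ i → 1 ≤ i → i ≤ n → height q i ≤ height q' i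

-- Increasing m-fan of Dyck paths in D_n (q_j indexed by Fin m, j ↦ q_{j+1}).
IsIncreasingFan : (m n : ℕ) → (Fin m → Path) → Set
IsIncreasingFan m n q =
  (∀ j → IsDyck n (q j)) × (∀ j k → toℕ j ≤ toℕ k → q j ≤dom[ n ] q k)

-- Interleave the heights of the fan column by column: the sequence
-- h₁⁽¹⁾, …, h₁⁽ᵐ⁾, h₂⁽¹⁾, …, h₂⁽ᵐ⁾, … is the only candidate for the height sequence of 𝔭,
-- and its strips are the given paths. It satisfies m hₖ ≥ k because each 𝔮ⱼ is a Dyck path, and
-- it is weakly increasing inside a column because the fan is increasing. So it is a height
-- sequence exactly when it increases across columns, hᵢ⁽ᵐ⁾ ≤ hᵢ₊₁⁽¹⁾; by dominance this is the
-- stated family of inequalities, which is automatic for i = n - 1 since hₙ⁽¹⁾ = n.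
module Submission where

open import Defs
open import Data.Nat using (ℕ; zero; suc; _+_; _*_; _∸_; _≤_; _<_; z≤n; s≤s; z<s; _<?_)
open import Data.Nat.Properties
open import Data.Nat.DivMod using (_/_; _%_; _mod_; _divMod_; DivMod; [m+kn]%n≡m%n; m<n⇒m%n≡m)
open import Data.List using ([]; _∷_; _++_; replicate; take; applyUpTo)
open import Data.List.Properties using (map-upTo)
open import Data.Fin as Fin using (Fin; toℕ; fromℕ; fromℕ<)
open import Data.Fin.Properties using (toℕ-injective; toℕ-fromℕ<; toℕ-fromℕ; toℕ<n)
open import Data.Product using (Σ; _×_; _,_; proj₁)
open import Data.Empty using (⊥-elim)
open import Function using (_∘_)
open import Function.Bundles using (_⇔_; mk⇔)
open import Relation.Nullary using (yes; no)
open import Relation.Binary.PropositionalEquality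

countN-++ : ∀ p p′ → countN (p ++ p′) ≡ countN p + countN p′
countN-++ []      p′ = refl
countN-++ (N ∷ p) p′ = cong suc (countN-++ p p′)
countN-++ (E ∷ p) p′ = countN-++ p p′

countE-++ : ∀ p p′ → countE (p ++ p′) ≡ countE p + countE p′
countE-++ []      p′ = refl
countE-++ (N ∷ p) p′ = countE-++ p p′
countE-++ (E ∷ p) p′ = cong suc (countE-++ p p′)

countN-replicate : ∀ k → countN (replicate k N) ≡ k
countN-replicate zero    = refl
countN-replicate (suc k) = cong suc (countN-replicate k)

countE-replicate : ∀ k → countE (replicate k N) ≡ 0
countE-replicate zero    = refl
countE-replicate (suc k) = countE-replicate k

hgt-replicate-++ : ∀ k p t → hgt (replicate k N ++ p) t ≡ k + hgt p t
hgt-replicate-++ zero    p t = refl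
hgt-replicate-++ (suc k) p t = cong suc (hgt-replicate-++ k p t)

hgt-mono : ∀ p {s t} → s ≤ t → hgt p s ≤ hgt p t
hgt-mono []      _         = z≤n
hgt-mono (N ∷ p) s≤t       = s≤s (hgt-mono p s≤t)
hgt-mono (E ∷ p) {zero}  _ = z≤n
hgt-mono (E ∷ p) {suc s} {suc t} (s≤s s≤t) = hgt-mono p s≤t

hgt≤countN : ∀ p t → hgt p t ≤ countN p
hgt≤countN []      t       = z≤n
hgt≤countN (N ∷ p) t       = s≤s (hgt≤countN p t)
hgt≤countN (E ∷ p) zero    = z≤n
hgt≤countN (E ∷ p) (suc t) = hgt≤countN p t

hgt-injective : ∀ p p′ → countN p ≡ countN p′ → countE p ≡ countE p′ →
                (∀ t → t < countE p → hgt p t ≡ hgt p′ t) → p ≡ p′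
hgt-injective []      []       _  _  _ = refl
hgt-injective []      (N ∷ p′) () _  _
hgt-injective []      (E ∷ p′) _  () _
hgt-injective (N ∷ p) []       () _  _
hgt-injective (E ∷ p) []       _  () _
hgt-injective (N ∷ p) (N ∷ p′) eN eE h =
  cong (N ∷_) (hgt-injective p p′ (suc-injective eN) eE (λ t t< → suc-injective (h t t<)))
hgt-injective (E ∷ p) (E ∷ p′) eN eE h =
  cong (E ∷_) (hgt-injective p p′ eN (suc-injective eE) (λ t t< → h (suc t) (s≤s t<)))
hgt-injective (N ∷ p) (E ∷ p′) _  eE h = ⊥-elim (1+n≢0 (h 0 (subst (0 <_) (sym eE) z<s)))
hgt-injective (E ∷ p) (N ∷ p′) _  _  h = ⊥-elim (0≢1+n (h 0 z<s))

IncreasingUpTo : (ℕ → ℕ) → ℕ → Set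
IncreasingUpTo G L = ∀ t → suc t < L → G t ≤ G (suc t)

increasing-tail : ∀ {G L} → IncreasingUpTo G (suc L) → IncreasingUpTo (G ∘ suc) L
increasing-tail inc t t+1<L = inc (suc t) (s≤s t+1<L)

increasing-head : ∀ {G L} → IncreasingUpTo G (suc L) → 0 < L → G 0 ≤ G 1
increasing-head inc 0<L = inc 0 (s≤s 0<L)

m+[[n∸m]+o]≡n+o : ∀ {m n} o → m ≤ n → m + ((n ∸ m) + o) ≡ n + o
m+[[n∸m]+o]≡n+o {m} o m≤n = trans (sym (+-assoc m _ o)) (cong (_+ o) (m+[n∸m]≡n m≤n))

hgt-fromHeightsFrom : ∀ n cur G L → IncreasingUpTo G L → (0 < L → cur ≤ G 0) →
  ∀ t → t < L → cur + hgt (fromHeightsFrom n cur (applyUpTo G L)) t ≡ G t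
hgt-fromHeightsFrom n cur G (suc L) inc start t t<L = begin
  cur + hgt (replicate (G 0 ∸ cur) N ++ E ∷ rest) t ≡⟨ cong (cur +_) (hgt-replicate-++ (G 0 ∸ cur) _ t) ⟩
  cur + ((G 0 ∸ cur) + hgt (E ∷ rest) t)            ≡⟨ m+[[n∸m]+o]≡n+o _ (start z<s) ⟩
  G 0 + hgt (E ∷ rest) t                            ≡⟨ shifted t t<L ⟩
  G t                                               ∎
  where
  open ≡-Reasoning
  rest : Path
  rest = fromHeightsFrom n (G 0) (applyUpTo (G ∘ suc) L)
  shifted : ∀ t → t < suc L → G 0 + hgt (E ∷ rest) t ≡ G t
  shifted zero    _          = +-identityʳ (G 0)
  shifted (suc t) (s≤s t<L) =
    hgt-fromHeightsFrom n (G 0) (G ∘ suc) L (increasing-tail inc) (increasing-head inc) t t<L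

countN-fromHeightsFrom : ∀ n cur G L → IncreasingUpTo G L → (0 < L → cur ≤ G 0) →
  (∀ t → t < L → G t ≤ n) → cur ≤ n → cur + countN (fromHeightsFrom n cur (applyUpTo G L)) ≡ n
countN-fromHeightsFrom n cur G zero _ _ _ cur≤n =
  trans (cong (cur +_) (countN-replicate (n ∸ cur))) (m+[n∸m]≡n cur≤n)
countN-fromHeightsFrom n cur G (suc L) inc start bounded _ = begin
  cur + countN (replicate (G 0 ∸ cur) N ++ E ∷ rest)
    ≡⟨ cong (cur +_) (countN-++ (replicate (G 0 ∸ cur) N) (E ∷ rest)) ⟩
  cur + (countN (replicate (G 0 ∸ cur) N) + countN rest)
    ≡⟨ cong (λ k → cur + (k + countN rest)) (countN-replicate (G 0 ∸ cur)) ⟩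
  cur + ((G 0 ∸ cur) + countN rest)
    ≡⟨ m+[[n∸m]+o]≡n+o _ (start z<s) ⟩
  G 0 + countN rest
    ≡⟨ countN-fromHeightsFrom n (G 0) (G ∘ suc) L (increasing-tail inc) (increasing-head inc)
         (λ t t<L → bounded (suc t) (s≤s t<L)) (bounded 0 z<s) ⟩
  n ∎
  where
  open ≡-Reasoning
  rest : Path
  rest = fromHeightsFrom n (G 0) (applyUpTo (G ∘ suc) L)

countE-fromHeightsFrom : ∀ n cur G L → countE (fromHeightsFrom n cur (applyUpTo G L)) ≡ L
countE-fromHeightsFrom n cur G zero    = countE-replicate (n ∸ cur)
countE-fromHeightsFrom n cur G (suc L) =
  trans (countE-++ (replicate (G 0 ∸ cur) N) _)
        (cong₂ (λ a b → a + suc b) (countE-replicate (G 0 ∸ cur))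
               (countE-fromHeightsFrom n (G 0) (G ∘ suc) L))

-- Both say that p, started at the lattice point (a , b), stays weakly above x = m y;
-- the second only inspects the right end of each east step.
PrefixesAbove : ℕ → ℕ → ℕ → Path → Set
PrefixesAbove m a b p = ∀ k → a + countE (take k p) ≤ m * (b + countN (take k p))

HeightsAbove : ℕ → ℕ → ℕ → Path → Set
HeightsAbove m a b p = ∀ t → t < countE p → suc (a + t) ≤ m * (b + hgt p t)

prefixesAbove⇒heightsAbove : ∀ m p a b → PrefixesAbove m a b p → HeightsAbove m a b p
prefixesAbove⇒heightsAbove m (N ∷ p) a b above t t< =
  subst (λ x → suc (a + t) ≤ m * x) (sym (+-suc b _))
    (prefixesAbove⇒heightsAbove m p a (suc b)
      (λ k → subst (λ x → a + countE (take k p) ≤ m * x) (+-suc b _) (above (suc k))) t t<)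
prefixesAbove⇒heightsAbove m (E ∷ p) a b above zero _ =
  subst (λ x → x ≤ m * (b + 0)) (+-suc a 0) (above 1)
prefixesAbove⇒heightsAbove m (E ∷ p) a b above (suc t) (s≤s t<) =
  subst (λ x → suc x ≤ m * (b + hgt p t)) (sym (+-suc a t))
    (prefixesAbove⇒heightsAbove m p (suc a) b
      (λ k → subst (λ x → x ≤ m * (b + countN (take k p))) (+-suc a _) (above (suc k))) t t<)

heightsAbove⇒prefixesAbove : ∀ m p a b → a ≤ m * b → HeightsAbove m a b p → PrefixesAbove m a b p
heightsAbove⇒prefixesAbove m p a b start _ zero
  rewrite +-identityʳ a | +-identityʳ b = start
heightsAbove⇒prefixesAbove m [] a b start _ (suc k)
  rewrite +-identityʳ a | +-identityʳ b = start
heightsAbove⇒prefixesAbove m (N ∷ p) a b start above (suc k) rewrite +-suc b (countN (take k p)) =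
  heightsAbove⇒prefixesAbove m p a (suc b) (≤-trans start (*-monoʳ-≤ m (n≤1+n b)))
    (λ t t< → subst (λ x → suc (a + t) ≤ m * x) (+-suc b _) (above t t<)) k
heightsAbove⇒prefixesAbove m (E ∷ p) a b start above (suc k) rewrite +-suc a (countE (take k p)) =
  heightsAbove⇒prefixesAbove m p (suc a) b
    (subst₂ (λ x y → suc x ≤ m * y) (+-identityʳ a) (+-identityʳ b) (above 0 z<s))
    (λ t t< → subst (λ x → suc x ≤ m * (b + hgt p t)) (+-suc a t) (above (suc t) (s≤s t<))) k

isMDyck⇒hgt≤ : ∀ {m n p} → IsMDyck m n p → ∀ t → hgt p t ≤ n
isMDyck⇒hgt≤ {p = p} (countN≡n , _ , _) t = subst (hgt p t ≤_) countN≡n (hgt≤countN p t)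

isMDyck⇒heightsAbove : ∀ {m n p} → IsMDyck m n p → ∀ t → t < m * n → suc t ≤ m * hgt p t
isMDyck⇒heightsAbove {m} {p = p} (_ , countE≡mn , above) t t<mn =
  prefixesAbove⇒heightsAbove m p 0 0 above t (subst (t <_) (sym countE≡mn) t<mn)

heightsAbove⇒isMDyck : ∀ {m n p} → countN p ≡ n → countE p ≡ m * n →
  (∀ t → t < m * n → suc t ≤ m * hgt p t) → IsMDyck m n p
heightsAbove⇒isMDyck {m} {p = p} countN≡n countE≡mn above =
  countN≡n , countE≡mn ,
  heightsAbove⇒prefixesAbove m p 0 0 z≤n (λ t t< → above t (subst (t <_) countE≡mn t<))

isDyck⇒countE : ∀ {n q} → IsDyck n q → countE q ≡ n
isDyck⇒countE {n} (_ , countE≡n , _) = trans countE≡n (*-identityˡ n)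

isDyck⇒heightsAbove : ∀ {n q} → IsDyck n q → ∀ l → l < n → suc l ≤ hgt q l
isDyck⇒heightsAbove {n} {q} dyck l l<n =
  subst (suc l ≤_) (*-identityˡ (hgt q l))
    (isMDyck⇒heightsAbove {m = 1} dyck l (subst (l <_) (sym (*-identityˡ n)) l<n))

slot< : ∀ {m} (j : Fin m) l {h} → l < h → toℕ j + l * m < m * h
slot< {m} j l {h} l<h = begin-strict
  toℕ j + l * m <⟨ +-monoˡ-< (l * m) (toℕ<n j) ⟩
  m + l * m     ≡⟨ *-comm (suc l) m ⟩
  m * suc l     ≤⟨ *-monoʳ-≤ m l<h ⟩
  m * h         ∎
  where open ≤-Reasoning

slot<⇒< : ∀ m r l {n} → r + l * m < m * n → l < n
slot<⇒< m r l {n} lt = *-cancelʳ-< m l n (≤-<-trans (m≤n+m (l * m) r) (subst (r + l * m <_) (*-comm m n) lt))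

strip-increasing : ∀ {m} p (k : Fin m) L → IncreasingUpTo (λ l → height p (suc (toℕ k) + l * m)) L
strip-increasing {m} p k L t _ = hgt-mono p (+-monoʳ-≤ (toℕ k) (m≤n+m (t * m) m))

hgt-δ : ∀ m n p (k : Fin m) l → l < n → hgt (δ m n p k) l ≡ hgt p (toℕ k + l * m)
hgt-δ m n p k l l<n rewrite map-upTo (λ l → height p (suc (toℕ k) + l * m)) n =
  hgt-fromHeightsFrom n 0 _ n (strip-increasing p k n) (λ _ → z≤n) l l<n

countN-δ : ∀ m n p (k : Fin m) → countN p ≡ n → countN (δ m n p k) ≡ n
countN-δ m n p k countN≡n rewrite map-upTo (λ l → height p (suc (toℕ k) + l * m)) n =
  countN-fromHeightsFrom n 0 _ n (strip-increasing p k n) (λ _ → z≤n)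
    (λ t _ → subst (hgt p _ ≤_) countN≡n (hgt≤countN p _)) z≤n

countE-δ : ∀ m n p (k : Fin m) → countE (δ m n p k) ≡ n
countE-δ m n p k rewrite map-upTo (λ l → height p (suc (toℕ k) + l * m)) n =
  countE-fromHeightsFrom n 0 _ n

-- The right-hand side of the theorem, in the paper's 1-based indexing.
Interlacing : (m n : ℕ) → (Fin m → Path) → Set
Interlacing m n q = ∀ i → 1 ≤ i → i ≤ n ∸ 2 → ∀ (j k : Fin m) → toℕ j < toℕ k →
  height (q k) i ≤ height (q j) (suc i)

Interlacing-resp : ∀ {m n q q′} → (∀ j → q j ≡ q′ j) → Interlacing m n q → Interlacing m n q′
Interlacing-resp q≡q′ interlacing i 1≤i i≤n∸2 j k j<k =
  subst₂ _≤_ (cong (λ r → height r i) (q≡q′ k)) (cong (λ r → height r (suc i)) (q≡q′ j))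
    (interlacing i 1≤i i≤n∸2 j k j<k)

1+m≤n∸2⇒1+m<n : ∀ {m} n → suc m ≤ n ∸ 2 → suc m < n
1+m≤n∸2⇒1+m<n (suc (suc n)) m<n = s≤s (m≤n⇒m≤1+n m<n)

2+m≤n⇒m≤n∸2 : ∀ {m} n → 2 + m ≤ n → m ≤ n ∸ 2
2+m≤n⇒m≤n∸2 (suc (suc n)) (s≤s (s≤s m≤n)) = m≤n

δ-interlacing : ∀ m n p → Interlacing m n (δ m n p)
δ-interlacing m n p (suc l) _ l+1≤n∸2 j k _ = begin
  hgt (δ m n p k) l           ≡⟨ hgt-δ m n p k l (<-trans (n<1+n l) l+1<n) ⟩
  hgt p (toℕ k + l * m)       ≤⟨ hgt-mono p (≤-trans (+-monoˡ-≤ (l * m) (<⇒≤ (toℕ<n k))) (m≤n+m _ (toℕ j))) ⟩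
  hgt p (toℕ j + suc l * m)   ≡⟨ hgt-δ m n p j (suc l) l+1<n ⟨
  hgt (δ m n p j) (suc l)     ∎
  where
  open ≤-Reasoning
  l+1<n : suc l < n
  l+1<n = 1+m≤n∸2⇒1+m<n n l+1≤n∸2

-- The condition stops at i = n - 2: in the last column 𝔮₁ has already reached height n.
last≤first : ∀ {m′ n} (q : Fin (suc m′) → Path) → (∀ j → IsDyck n (q j)) → Interlacing (suc m′) n q →
  ∀ l → suc l < n → hgt (q (fromℕ m′)) l ≤ hgt (q Fin.zero) (suc l)
last≤first {zero} q _ _ l _ = hgt-mono (q Fin.zero) (n≤1+n l)
last≤first {suc m′} {n} q dyck interlacing l l+1<n with suc (suc l) <? n
... | yes l+2<n = interlacing (suc l) (s≤s z≤n) (2+m≤n⇒m≤n∸2 n l+2<n) Fin.zero (fromℕ (suc m′)) (s≤s z≤n)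
... | no l+2≮n = begin
  hgt (q (fromℕ (suc m′))) l ≤⟨ isMDyck⇒hgt≤ {m = 1} (dyck _) l ⟩
  n                          ≤⟨ ≮⇒≥ l+2≮n ⟩
  suc (suc l)                ≤⟨ isDyck⇒heightsAbove (dyck Fin.zero) (suc l) l+1<n ⟩
  hgt (q Fin.zero) (suc l)   ∎
  where open ≤-Reasoning

module Interleaving {m′ : ℕ} (q : Fin (suc m′) → Path) where

  m : ℕ
  m = suc m′

  interleave : ℕ → ℕ
  interleave t = hgt (q (t mod m)) (t / m)

  by-slots : {P : ℕ → Set} → (∀ (j : Fin m) l → P (toℕ j + l * m)) → ∀ t → P t
  by-slots {P} f t = subst P (sym (DivMod.property (t divMod m))) (f (t mod m) (t / m))

  mod-slot : ∀ (j : Fin m) l → (toℕ j + l * m) mod m ≡ j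
  mod-slot j l = toℕ-injective (begin
    toℕ ((toℕ j + l * m) mod m) ≡⟨ toℕ-fromℕ< _ ⟩
    (toℕ j + l * m) % m         ≡⟨ [m+kn]%n≡m%n (toℕ j) l m ⟩
    toℕ j % m                   ≡⟨ m<n⇒m%n≡m (toℕ<n j) ⟩
    toℕ j                       ∎)
    where open ≡-Reasoning

  div-slot : ∀ (j : Fin m) l → (toℕ j + l * m) / m ≡ l
  div-slot j l = sym (*-cancelʳ-≡ l _ m (+-cancelˡ-≡ (toℕ j) _ _ (begin
    toℕ j + l * m             ≡⟨ DivMod.property (t divMod m) ⟩
    toℕ (t mod m) + t / m * m ≡⟨ cong (λ i → toℕ i + t / m * m) (mod-slot j l) ⟩
    toℕ j + t / m * m         ∎)))
    where
    open ≡-Reasoning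
    t : ℕ
    t = toℕ j + l * m

  interleave-slot : ∀ (j : Fin m) l → interleave (toℕ j + l * m) ≡ hgt (q j) l
  interleave-slot j l = cong₂ (λ i k → hgt (q i) k) (mod-slot j l) (div-slot j l)

  interleave-increasing : ∀ {n} → (∀ j k → toℕ j ≤ toℕ k → q j ≤dom[ n ] q k) →
    (∀ l → suc l < n → hgt (q (fromℕ m′)) l ≤ hgt (q Fin.zero) (suc l)) →
    IncreasingUpTo interleave (m * n)
  interleave-increasing {n} dominated wrap = by-slots step
    where
    open ≤-Reasoning
    step : ∀ j l → suc (toℕ j + l * m) < m * n → interleave (toℕ j + l * m) ≤ interleave (suc (toℕ j + l * m))
    step j l lt with suc (toℕ j) <? m
    ... | yes j+1<m = begin
      interleave (toℕ j + l * m)       ≡⟨ interleave-slot j l ⟩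
      hgt (q j) l                      ≤⟨ dominated j j′ j≤j′ (suc l) (s≤s z≤n) (slot<⇒< m (suc (toℕ j)) l lt) ⟩
      hgt (q j′) l                     ≡⟨ interleave-slot j′ l ⟨
      interleave (toℕ j′ + l * m)      ≡⟨ cong (λ i → interleave (i + l * m)) (toℕ-fromℕ< j+1<m) ⟩
      interleave (suc (toℕ j) + l * m) ∎
      where
      j′ : Fin m
      j′ = fromℕ< j+1<m
      j≤j′ : toℕ j ≤ toℕ j′
      j≤j′ = subst (toℕ j ≤_) (sym (toℕ-fromℕ< j+1<m)) (n≤1+n _)
    ... | no j+1≮m = begin
      interleave (toℕ j + l * m)       ≡⟨ interleave-slot j l ⟩
      hgt (q j) l                      ≡⟨ cong (λ i → hgt (q i) l) j≡last ⟩
      hgt (q (fromℕ m′)) l             ≤⟨ wrap l (slot<⇒< m 0 (suc l) lt′) ⟩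
      hgt (q Fin.zero) (suc l)         ≡⟨ interleave-slot Fin.zero (suc l) ⟨
      interleave (m + l * m)           ≡⟨ cong (λ i → interleave (suc i + l * m)) j≡m′ ⟨
      interleave (suc (toℕ j + l * m)) ∎
      where
      j≡m′ : toℕ j ≡ m′
      j≡m′ = suc-injective (≤-antisym (toℕ<n j) (≮⇒≥ j+1≮m))
      j≡last : j ≡ fromℕ m′
      j≡last = toℕ-injective (trans j≡m′ (sym (toℕ-fromℕ m′)))
      lt′ : m + l * m < m * n
      lt′ = subst (λ i → suc (i + l * m) < m * n) j≡m′ lt

  interleave-heightsAbove : ∀ {n} → (∀ j → IsDyck n (q j)) → ∀ t → t < m * n → suc t ≤ m * interleave t
  interleave-heightsAbove dyck = by-slots λ j l lt → begin
    suc (toℕ j + l * m)            ≤⟨ slot< j l (isDyck⇒heightsAbove (dyck j) l (slot<⇒< m (toℕ j) l lt)) ⟩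
    m * hgt (q j) l                ≡⟨ cong (m *_) (interleave-slot j l) ⟨
    m * interleave (toℕ j + l * m) ∎
    where open ≤-Reasoning

  interleave≤ : ∀ {n} → (∀ j → IsDyck n (q j)) → ∀ t → interleave t ≤ n
  interleave≤ dyck t = isMDyck⇒hgt≤ {m = 1} (dyck (t mod m)) (t / m)

module Reconstruction {m′ n : ℕ} (q : Fin (suc m′) → Path) (dyck : ∀ j → IsDyck n (q j))
  (increasing : IncreasingUpTo (Interleaving.interleave q) (suc m′ * n)) where

  open Interleaving q

  path : Path
  path = fromHeights n (applyUpTo interleave (m * n))

  hgt-path : ∀ t → t < m * n → hgt path t ≡ interleave t
  hgt-path = hgt-fromHeightsFrom n 0 interleave (m * n) increasing (λ _ → z≤n)

  path-isMDyck : IsMDyck m n path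
  path-isMDyck = heightsAbove⇒isMDyck {m = m}
    (countN-fromHeightsFrom n 0 interleave (m * n) increasing (λ _ → z≤n) (λ t _ → interleave≤ dyck t) z≤n)
    (countE-fromHeightsFrom n 0 interleave (m * n))
    (λ t t< → subst (λ h → suc t ≤ m * h) (sym (hgt-path t t<)) (interleave-heightsAbove dyck t t<))

  q≡δ-path : ∀ j → q j ≡ δ m n path j
  q≡δ-path j = hgt-injective (q j) (δ m n path j)
    (trans countN≡n (sym (countN-δ m n path j (proj₁ path-isMDyck))))
    (trans (isDyck⇒countE (dyck j)) (sym (countE-δ m n path j)))
    (λ l l< → hgt-strip l (subst (l <_) (isDyck⇒countE (dyck j)) l<))
    where
    countN≡n : countN (q j) ≡ n
    countN≡n = proj₁ (dyck j)
    hgt-strip : ∀ l → l < n → hgt (q j) l ≡ hgt (δ m n path j) l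
    hgt-strip l l<n = begin
      hgt (q j) l                ≡⟨ interleave-slot j l ⟨
      interleave (toℕ j + l * m) ≡⟨ hgt-path _ (slot< j l l<n) ⟨
      hgt path (toℕ j + l * m)   ≡⟨ hgt-δ m n path j l l<n ⟨
      hgt (δ m n path j) l       ∎
      where open ≡-Reasoning

proposition3p26 : (m n : ℕ) → 1 ≤ m → 1 ≤ n → (q : Fin m → Path) → IsIncreasingFan m n q →
    (Σ Path (λ p → IsMDyck m n p × (∀ j → q j ≡ δ m n p j)))
      ⇔ (∀ i → 1 ≤ i → i ≤ n ∸ 2 → ∀ (j k : Fin m) → toℕ j < toℕ k →
           height (q k) i ≤ height (q j) (suc i))
proposition3p26 (suc m′) n _ _ q (dyck , dominated) = mk⇔
  (λ (p , _ , q≡δp) → Interlacing-resp {n = n} (λ j → sym (q≡δp j)) (δ-interlacing (suc m′) n p))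
  (λ interlacing →
    let open Reconstruction q dyck (interleave-increasing dominated (last≤first q dyck interlacing))
    in path , path-isMDyck , q≡δ-path)
  where open Interleaving q
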